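{- Let $\mathbb F$ be a flower of a graph $G$ and let $B_1,B_2,B_3,B_4$ be distinct petals of $\mathbb F$. Then there is a non-crossing w-sequence $\mathbb S$ for the flower $\mathbb F$ such that, in $H=\operatorname{Wflip}[G,\mathbb S]$, both $B_1,B_2$ and $B_3,B_4$ are pairs of consecutive petals of $\mathbb F$.
   Context: Graphs are finite with possible parallel edges. For $X\subseteq E(G)$: $\bar X=E(G)-X$, $V_G(X)$ = vertices incident with edges of $X$, $G[X]$ = subgraph with vertex set $V_G(X)$ and edge set $X$, $\mathcal B_G(X)=V_G(X)\cap V_G(\bar X)$. $X$ is a $2$-separation if $\min\{|X|,|\bar X|\}\ge2$, $|\mathcal B_G(X)|=2$, $G[X],G[\bar X]$ connected. Whitney-flip on a $2$-separation $X$ with boundary $\{u_1,u_2\}$: interchange the ends $u_1,u_2$ in every edge of $X$. $\operatorname{Wflip}[G,(X_1,\dots,X_k)]$ is the result of flipping $X_1,\dots,X_k$ in order (each a $2$-separation of the current graph). A partition $\mathbb F=\{B_1,\dots,B_t\}$ of $E(G)$, $t\ge2$, is a flower if there are distinct $u_1,\dots,u_t$ with each $G[B_i]$ connected and $\mathcal B_G(B_i)=\{u_i,u_{i+1}\}$ (indices mod $t$); the $B_i$ are petals. A $2$-separation of $\mathbb F$ is a $2$-separation which is a union of petals. A w-sequence $(X_1,\dots,X_k)$ for $\mathbb F$: each $X_i$ is a $2$-separation of $\mathbb F$ in the graph obtained by flipping $X_1,\dots,X_{i-1}$. It is non-crossing if no two members $X,Y$ cross (i.e. $X\cap Y$, $X-Y$,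 $Y-X$, $\bar X\cap\bar Y$ all nonempty). Distinct petals $B_i,B_j$ are consecutive in a graph if they share a vertex in it. -}

module Defs where

open import Data.Nat using (ℕ; zero; suc; _≥_)
open import Data.Fin using (Fin; zero; suc; _≟_)
open import Data.Fin.Subset using (Subset; _∈_; _∉_; ∁; ∣_∣; Nonempty; _∩_)
open import Data.Product using (Σ; ∃; _×_; _,_; proj₁; proj₂)
open import Data.Sum using (_⊎_)
open import Data.List using (List; []; _∷_)
open import Data.List.Membership.Propositional using () renaming (_∈_ to _∈L_)
open import Relation.Nullary using (¬_; yes; no)
open import Relation.Binary.PropositionalEquality using (_≡_; _≢_)
open import Function using (Injective)

-- A graph with vertex set Fin n and edge set Fin m (parallel edges and
-- loops allowed): each edge is mapped to its (unordered) pair of ends.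
Graph : ℕ → ℕ → Set
Graph n m = Fin m → Fin n × Fin n

EdgeSet : ℕ → Set
EdgeSet m = Subset m

module _ {n m : ℕ} where

  IsEnd : Graph n m → Fin m → Fin n → Set
  IsEnd G e v = (proj₁ (G e) ≡ v) ⊎ (proj₂ (G e) ≡ v)

  InV : Graph n m → EdgeSet m → Fin n → Set
  InV G X v = ∃ λ e → e ∈ X × IsEnd G e v

  InB : Graph n m → EdgeSet m → Fin n → Set
  InB G X v = InV G X v × InV G (∁ X) v

  BoundaryIs : Graph n m → EdgeSet m → Fin n → Fin n → Set
  BoundaryIs G X u₁ u₂ =
    u₁ ≢ u₂ × (∀ v → (InB G X v → (v ≡ u₁ ⊎ v ≡ u₂)) × ((v ≡ u₁ ⊎ v ≡ u₂) → InB G X v))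

  data Walk (G : Graph n m) (X : EdgeSet m) : Fin n → Fin n → Set where
    here : ∀ {u} → Walk G X u u
    stepF : ∀ {w} e → e ∈ X → Walk G X (proj₂ (G e)) w → Walk G X (proj₁ (G e)) w
    stepB : ∀ {w} e → e ∈ X → Walk G X (proj₁ (G e)) w → Walk G X (proj₂ (G e)) w

  Connected : Graph n m → EdgeSet m → Set
  Connected G X = ∀ u v → InV G X u → InV G X v → Walk G X u v

  TwoSep : Graph n m → EdgeSet m → Set
  TwoSep G X = ∣ X ∣ ≥ 2 × ∣ ∁ X ∣ ≥ 2
             × (∃ λ u₁ → ∃ λ u₂ → BoundaryIs G X u₁ u₂)
             × Connected G X × Connected G (∁ X)

  swapV : Fin n → Fin n → Fin n → Fin n
  swapV u₁ u₂ v with v ≟ u₁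
  ... | yes _ = u₂
  ... | no _ with v ≟ u₂
  ... | yes _ = u₁
  ... | no _ = v

  Flip : Graph n m → EdgeSet m → Graph n m → Set
  Flip G X G' = ∃ λ u₁ → ∃ λ u₂ → BoundaryIs G X u₁ u₂
    × (∀ e → e ∈ X → G' e ≡ (swapV u₁ u₂ (proj₁ (G e)) , swapV u₁ u₂ (proj₂ (G e))))
    × (∀ e → e ∉ X → G' e ≡ G e)

nextF : ∀ {k} → Fin (suc k) → Fin (suc k)
nextF {zero} zero = zero
nextF {suc k} zero = suc zero
nextF {suc k} (suc i) with nextF {k} i
... | zero = zero
... | suc j = suc (suc j)

module _ {n m t : ℕ} where

  IsPartition : (Fin t → EdgeSet m) → Set
  IsPartition P = ∀ e → ∃ λ i → e ∈ P i × (∀ j → e ∈ P j → j ≡ i)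

  UnionOfPetals : (Fin t → EdgeSet m) → EdgeSet m → Set
  UnionOfPetals P X = ∀ i → (∀ e → e ∈ P i → e ∈ X) ⊎ (∀ e → e ∈ P i → e ∉ X)

  TwoSepOf : Graph n m → (Fin t → EdgeSet m) → EdgeSet m → Set
  TwoSepOf G P X = TwoSep G X × UnionOfPetals P X

  -- WSeq G P S H : S is a w-sequence for the flower P (starting in G)
  -- and H = Wflip[G, S]
  data WSeq (P : Fin t → EdgeSet m) : Graph n m → List (EdgeSet m) → Graph n m → Set where
    wnil  : ∀ {G} → WSeq P G [] G
    wcons : ∀ {G G' H X Xs} → TwoSepOf G P X → Flip G X G' → WSeq P G' Xs H
          → WSeq P G (X ∷ Xs) H

  Consecutive : Graph n m → (Fin t → EdgeSet m) → Fin t → Fin t → Set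
  Consecutive H P i j = i ≢ j × (∃ λ v → InV H (P i) v × InV H (P j) v)

Cross : ∀ {m} → EdgeSet m → EdgeSet m → Set
Cross X Y = Nonempty (X ∩ Y) × Nonempty (X ∩ ∁ Y) × Nonempty (Y ∩ ∁ X) × Nonempty (∁ X ∩ ∁ Y)

NonCrossing : ∀ {m} → List (EdgeSet m) → Set
NonCrossing S = ∀ X Y → X ∈L S → Y ∈L S → ¬ Cross X Y

-- P (indexed by Fin (suc k), t = suc k ≥ 2) is a flower of G, with petals
-- in the cyclic order of the indices
IsFlower : ∀ {n m k} → Graph n m → (Fin (suc k) → EdgeSet m) → Set
IsFlower {n} {m} {k} G P = suc k ≥ 2 × IsPartition {n} P ×
  (∃ λ (u : Fin (suc k) → Fin n) → Injective _≡_ _≡_ u ×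
    (∀ i → Connected G (P i) × BoundaryIs G (P i) (u i) (u (nextF i))))

-- Number the petals 0, …, k in cyclic order, petal i joining u i to u (i + 1). For an
-- interval [l, r] of petals whose complement contains at least two petals, the arc
-- P l ∪ … ∪ P r is a 2-separation with boundary {u l, u (r + 1)}, and flipping it makes
-- petal l incident with u (r + 1) and petal r incident with u l. Arcs of pairwise disjoint
-- intervals can be flipped one after another, giving a non-crossing w-sequence: a flip
-- only swaps two vertices of an arc already joined inside that arc, so the arc stays
-- connected, keeps its vertex set, and every arc flipped later is still a 2-separation
-- with the same boundary. Single petals are never flipped. With the four petals ordered
-- so that a < b, c < d and a < c, three configurations remain:
--   a < b < c < d : flip [a, b − 1] and [c, d − 1];
--   a < c < b < d : flip [a, c − 1], [c, b] and [b + 1, d];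
--   a < c < d < b : flip [0, a], [c, d − 1] and [b, k], so that petals a and b meet at u 0.

module Submission where

open import Defs
open import Data.Nat using (ℕ; zero; suc; _+_; _≤_; _<_; _≥_; z≤n; s≤s; _≤?_)
import Data.Nat.Properties as ℕ
open import Data.Fin using (Fin; zero; suc; toℕ; _≟_)
import Data.Fin.Properties as Fin
open import Data.Fin.Subset using (Subset; _∈_; _∉_; _⊆_; ∁; ∣_∣; ⁅_⁆)
open import Data.Fin.Subset.Properties
  using (_∈?_; x∈∁p⇒x∉p; x∉p⇒x∈∁p; p⊂q⇒∣p∣<∣q∣; x∈p∩q⁻; ∣⁅x⁆∣≡1; x∈⁅y⁆⇒x≡y)
open import Data.Product using (∃; _×_; _,_; proj₁; proj₂)
import Data.Product as Product
open import Data.Sum using (_⊎_; inj₁; inj₂)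
open import Data.Empty using (⊥-elim)
open import Function using (case_of_; _∘_; id)
open import Data.List using (List; []; _∷_; _∷ʳ_; map)
open import Data.List.Membership.Propositional using (find; lose) renaming (_∈_ to _∈L_)
open import Data.List.Membership.Propositional.Properties using (∈-map⁻; ∈-++⁻)
open import Data.List.Relation.Binary.Subset.Propositional using () renaming (_⊆_ to _⊆L_)
open import Data.List.Relation.Unary.Any using (here; there; any?)
import Data.List.Relation.Unary.All as All
open import Data.List.Relation.Unary.AllPairs using (AllPairs; []; _∷_)
open import Data.List.Relation.Unary.Linked using (Linked; [-]; _∷_)
open import Data.List.Relation.Unary.Linked.Properties using (Linked⇒AllPairs)
open import Data.Vec using (tabulate)
open import Data.Vec.Properties using (lookup∘tabulate; lookup⇒[]=; []=⇒lookup)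
open import Relation.Binary.Definitions using (tri<; tri≈; tri>)
open import Relation.Nullary using (¬_; Dec; yes; no; does)
open import Relation.Nullary.Decidable using (dec-true; _×-dec_)
open import Relation.Unary using (Pred; Decidable)
open import Level using (0ℓ)
open import Relation.Binary.PropositionalEquality

module _ {n m : ℕ} {G : Graph n m} where

  walk-mono : ∀ {X Y u v} → X ⊆ Y → Walk G X u v → Walk G Y u v
  walk-mono X⊆Y here            = here
  walk-mono X⊆Y (stepF e e∈X w) = stepF e (X⊆Y e∈X) (walk-mono X⊆Y w)
  walk-mono X⊆Y (stepB e e∈X w) = stepB e (X⊆Y e∈X) (walk-mono X⊆Y w)

  infixr 5 _++ʷ_
  _++ʷ_ : ∀ {X u v w} → Walk G X u v → Walk G X v w → Walk G X u w
  here            ++ʷ w′ = w′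
  stepF e e∈X w   ++ʷ w′ = stepF e e∈X (w ++ʷ w′)
  stepB e e∈X w   ++ʷ w′ = stepB e e∈X (w ++ʷ w′)

  reverseʷ : ∀ {X u v} → Walk G X u v → Walk G X v u
  reverseʷ here            = here
  reverseʷ (stepF e e∈X w) = reverseʷ w ++ʷ stepB e e∈X here
  reverseʷ (stepB e e∈X w) = reverseʷ w ++ʷ stepF e e∈X here

  edgeʷ : ∀ {X} e → e ∈ X → Walk G X (proj₁ (G e)) (proj₂ (G e))
  edgeʷ e e∈X = stepF e e∈X here

  InV-mono : ∀ {X Y v} → X ⊆ Y → InV G X v → InV G Y v
  InV-mono X⊆Y (e , e∈X , end) = e , X⊆Y e∈X , end

  Connected-cong : ∀ {X Y} → X ⊆ Y → Y ⊆ X → Connected G X → Connected G Y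
  Connected-cong X⊆Y Y⊆X conn u v u∈ v∈ =
    walk-mono X⊆Y (conn u v (InV-mono Y⊆X u∈) (InV-mono Y⊆X v∈))

  Connected-∪ : ∀ {X Y Z} w → Connected G X → Connected G Y → X ⊆ Z → Y ⊆ Z
              → (∀ {e} → e ∈ Z → e ∈ X ⊎ e ∈ Y)
              → InV G X w → InV G Y w → Connected G Z
  Connected-∪ {X} {Y} {Z} w connX connY X⊆Z Y⊆Z Z⊆X∪Y w∈X w∈Y u v u∈ v∈ =
    toW u u∈ ++ʷ reverseʷ (toW v v∈)
    where
    toW : ∀ x → InV G Z x → Walk G Z x w
    toW x (e , e∈Z , end) with Z⊆X∪Y e∈Z
    ... | inj₁ e∈X = walk-mono X⊆Z (connX x w (e , e∈X , end) w∈X)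
    ... | inj₂ e∈Y = walk-mono Y⊆Z (connY x w (e , e∈Y , end) w∈Y)

mapEnds : ∀ {n} → (Fin n → Fin n) → Fin n × Fin n → Fin n × Fin n
mapEnds f = Product.map f f

module _ {n m : ℕ} where

  walk-map : ∀ {G G′ : Graph n m} {X Y} (f : Fin n → Fin n)
           → (∀ {e} → e ∈ X → Walk G′ Y (f (proj₁ (G e))) (f (proj₂ (G e))))
           → ∀ {u v} → Walk G X u v → Walk G′ Y (f u) (f v)
  walk-map f edge here            = here
  walk-map f edge (stepF e e∈X w) = edge e∈X ++ʷ walk-map f edge w
  walk-map f edge (stepB e e∈X w) = reverseʷ (edge e∈X) ++ʷ walk-map f edge w

  IsEnd-map : ∀ {G₀ G : Graph n m} {e v} (f : Fin n → Fin n) → G e ≡ mapEnds f (G₀ e)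
            → IsEnd G₀ e v → IsEnd G e (f v)
  IsEnd-map f eq (inj₁ refl) = inj₁ (cong proj₁ eq)
  IsEnd-map f eq (inj₂ refl) = inj₂ (cong proj₂ eq)

  InV-map : ∀ {G₀ G : Graph n m} {X v} (f : Fin n → Fin n) → (∀ {e} → e ∈ X → G e ≡ mapEnds f (G₀ e))
          → InV G₀ X v → InV G X (f v)
  InV-map {G₀} {G} f relabelled (e , e∈X , end) = e , e∈X , IsEnd-map {G₀ = G₀} {G} f (relabelled e∈X) end

  IsEnd-unmap : ∀ {G₀ G : Graph n m} {e v} (f : Fin n → Fin n) → G e ≡ mapEnds f (G₀ e)
              → IsEnd G e v → ∃ λ z → IsEnd G₀ e z × f z ≡ v
  IsEnd-unmap {G₀} {e = e} f eq (inj₁ refl) = proj₁ (G₀ e) , inj₁ refl , sym (cong proj₁ eq)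
  IsEnd-unmap {G₀} {e = e} f eq (inj₂ refl) = proj₂ (G₀ e) , inj₂ refl , sym (cong proj₂ eq)

  -- swapV ignores the edge count m of its defining module, but only swapV {n} {m}
  -- at the graph's own m matches the relabelling in Flip.
  swap : Fin n → Fin n → Fin n → Fin n
  swap = swapV {n} {m}

  data SwapView (a b v : Fin n) : Fin n → Set where
    first  : v ≡ a → SwapView a b v b
    second : v ≡ b → SwapView a b v a
    other  : v ≢ a → v ≢ b → SwapView a b v v

  swapView : ∀ a b v → SwapView a b v (swap a b v)
  swapView a b v with v ≟ a
  ... | yes v≡a = first v≡a
  ... | no v≢a with v ≟ b
  ...   | yes v≡b = second v≡b
  ...   | no v≢b  = other v≢a v≢b

  swap-first : ∀ a b → swap a b a ≡ b
  swap-first a b with swap a b a | swapView a b a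
  ... | _ | first _       = refl
  ... | _ | second a≡b    = a≡b
  ... | _ | other a≢a _   = ⊥-elim (a≢a refl)

  swap-second : ∀ {a b} → a ≢ b → swap a b b ≡ a
  swap-second {a} {b} a≢b with swap a b b | swapView a b b
  ... | _ | first b≡a     = ⊥-elim (a≢b (sym b≡a))
  ... | _ | second _      = refl
  ... | _ | other _ b≢b   = ⊥-elim (b≢b refl)

two-members⇒∣∣≥2 : ∀ {m} {X : Subset m} {e₁ e₂} → e₁ ≢ e₂ → e₁ ∈ X → e₂ ∈ X → ∣ X ∣ ≥ 2
two-members⇒∣∣≥2 {X = X} {e₁} {e₂} e₁≢e₂ e₁∈X e₂∈X =
  subst (_< ∣ X ∣) (∣⁅x⁆∣≡1 e₁) (p⊂q⇒∣p∣<∣q∣ (⁅e₁⁆⊆X , e₂ , e₂∈X , e₂∉⁅e₁⁆))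
  where
  ⁅e₁⁆⊆X : ⁅ e₁ ⁆ ⊆ X
  ⁅e₁⁆⊆X x∈ = subst (_∈ X) (sym (x∈⁅y⁆⇒x≡y e₁ x∈)) e₁∈X
  e₂∉⁅e₁⁆ : e₂ ∉ ⁅ e₁ ⁆
  e₂∉⁅e₁⁆ e₂∈ = e₁≢e₂ (sym (x∈⁅y⁆⇒x≡y e₁ e₂∈))

module SwappedBlock {n m} (G₀ G : Graph n m) {B : Subset m} {a b : Fin n}
  (connB : Connected G₀ B) (a≢b : a ≢ b) (a∈B : InV G₀ B a) (b∈B : InV G₀ B b)
  (swapped : ∀ {e} → e ∈ B → G e ≡ mapEnds (swap {m = m} a b) (G₀ e)) where

  private
    σ : Fin n → Fin n
    σ = swap {m = m} a b

  swapped-edge : ∀ {e} → e ∈ B → Walk G B (σ (proj₁ (G₀ e))) (σ (proj₂ (G₀ e)))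
  swapped-edge e∈B =
    subst₂ (Walk G B) (cong proj₁ (swapped e∈B)) (cong proj₂ (swapped e∈B)) (edgeʷ _ e∈B)

  a↝b : Walk G B a b
  a↝b = subst₂ (Walk G B) (swap-second {m = m} a≢b) (swap-first {m = m} a b)
               (walk-map σ swapped-edge (connB b a b∈B a∈B))

  -- a and b stay joined inside G[B], so every vertex is joined there to its image under the swap.
  ↝swap : ∀ x → Walk G B x (σ x)
  ↝swap x with σ x | swapView {m = m} a b x
  ... | _ | first refl  = a↝b
  ... | _ | second refl = reverseʷ a↝b
  ... | _ | other _ _   = here

  unswapped-edge : ∀ {Y e} → B ⊆ Y → e ∈ B → Walk G Y (proj₁ (G₀ e)) (proj₂ (G₀ e))
  unswapped-edge B⊆Y e∈B = walk-mono B⊆Y (↝swap _ ++ʷ swapped-edge e∈B ++ʷ reverseʷ (↝swap _))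

  InV-unswap : ∀ {v} → InV G B v → InV G₀ B v
  InV-unswap (e , e∈B , end) with IsEnd-unmap {G₀ = G₀} {G} σ (swapped e∈B) end
  ... | z , end₀ , z↦v with σ z | swapView {m = m} a b z
  ...   | _ | first _   = subst (InV G₀ B) z↦v b∈B
  ...   | _ | second _  = subst (InV G₀ B) z↦v a∈B
  ...   | _ | other _ _ = e , e∈B , subst (IsEnd G₀ e) z↦v end₀

  InV-swap : ∀ {v} → InV G₀ B v → InV G B v
  InV-swap {v} v∈B with σ v | swapView {m = m} a b v | InV-map σ swapped v∈B
  ... | _ | first refl  | _      = subst (InV G B) (swap-second {m = m} a≢b) (InV-map σ swapped b∈B)
  ... | _ | second refl | _      = subst (InV G B) (swap-first {m = m} a b) (InV-map σ swapped a∈B)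
  ... | _ | other _ _   | v∈B′   = v∈B′

module _ {n m : ℕ} where

  SplitsAt : Graph n m → EdgeSet m → Fin n → Fin n → Set
  SplitsAt G X u₁ u₂ = BoundaryIs G X u₁ u₂ × Connected G X × Connected G (∁ X)

  SplitsAt⇒TwoSep : ∀ {G X u₁ u₂} → ∣ X ∣ ≥ 2 → ∣ ∁ X ∣ ≥ 2 → SplitsAt G X u₁ u₂ → TwoSep G X
  SplitsAt⇒TwoSep size size∁ (bd , conn , conn∁) = size , size∁ , (_ , _ , bd) , conn , conn∁

  SplitsAt-transfer : ∀ {G₀ G : Graph n m} {J α β}
    → (∀ {e} → e ∈ J → G e ≡ G₀ e)
    → (∀ {e} → e ∉ J → Walk G (∁ J) (proj₁ (G₀ e)) (proj₂ (G₀ e)))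
    → (∀ {v} → InV G (∁ J) v → InV G₀ (∁ J) v)
    → (∀ {v} → InV G₀ (∁ J) v → InV G (∁ J) v)
    → SplitsAt G₀ J α β → SplitsAt G J α β
  SplitsAt-transfer {G₀} {G} {J} {α} {β} same walk∁ to₀ from₀ ((α≢β , bd) , conn , conn∁) =
    (α≢β , bd′) , conn′ , conn∁′
    where
    InV-J : ∀ {v} → InV G J v → InV G₀ J v
    InV-J = InV-map {G₀ = G} {G₀} id (λ e∈J → sym (same e∈J))
    InV-J₀ : ∀ {v} → InV G₀ J v → InV G J v
    InV-J₀ = InV-map {G₀ = G₀} {G} id same
    bd′ : ∀ v → (InB G J v → v ≡ α ⊎ v ≡ β) × (v ≡ α ⊎ v ≡ β → InB G J v)
    bd′ v = (λ (v∈J , v∈∁J) → proj₁ (bd v) (InV-J v∈J , to₀ v∈∁J))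
          , (λ v∈αβ → let v∈J , v∈∁J = proj₂ (bd v) v∈αβ in InV-J₀ v∈J , from₀ v∈∁J)
    conn′ : Connected G J
    conn′ x y x∈ y∈ = walk-map id edge (conn x y (InV-J x∈) (InV-J y∈))
      where
      edge : ∀ {e} → e ∈ J → Walk G J (proj₁ (G₀ e)) (proj₂ (G₀ e))
      edge e∈J = subst₂ (Walk G J) (cong proj₁ (same e∈J)) (cong proj₂ (same e∈J)) (edgeʷ _ e∈J)
    conn∁′ : Connected G (∁ J)
    conn∁′ x y x∈ y∈ = walk-map id (λ e∈∁J → walk∁ (x∈∁p⇒x∉p e∈∁J)) (conn∁ x y (to₀ x∈) (to₀ y∈))

  whitneyFlip : Graph n m → EdgeSet m → Fin n → Fin n → Graph n m
  whitneyFlip G X a b e with e ∈? X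
  ... | yes _ = mapEnds (swap {m = m} a b) (G e)
  ... | no _  = G e

  whitneyFlip-∈ : ∀ {G X a b e} → e ∈ X → whitneyFlip G X a b e ≡ mapEnds (swap {m = m} a b) (G e)
  whitneyFlip-∈ {X = X} {e = e} e∈X with e ∈? X
  ... | yes _   = refl
  ... | no e∉X  = ⊥-elim (e∉X e∈X)

  whitneyFlip-∉ : ∀ {G X a b e} → e ∉ X → whitneyFlip G X a b e ≡ G e
  whitneyFlip-∉ {X = X} {e = e} e∉X with e ∈? X
  ... | yes e∈X = ⊥-elim (e∉X e∈X)
  ... | no _    = refl

  Flip-whitneyFlip : ∀ {G X a b} → BoundaryIs G X a b → Flip G X (whitneyFlip G X a b)
  Flip-whitneyFlip bd = _ , _ , bd , (λ _ → whitneyFlip-∈) , (λ _ → whitneyFlip-∉)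

  WSeq-snoc : ∀ {t} {P : Fin t → EdgeSet m} {G H H′ : Graph n m} {S X}
            → WSeq P G S H → TwoSepOf H P X → Flip H X H′ → WSeq P G (S ∷ʳ X) H′
  WSeq-snoc wnil                 sep flip = wcons sep flip wnil
  WSeq-snoc (wcons sep′ flip′ ws) sep flip = wcons sep′ flip′ (WSeq-snoc ws sep flip)

NonCrossing-⊆ : ∀ {m} {S T : List (EdgeSet m)} → S ⊆L T → NonCrossing T → NonCrossing S
NonCrossing-⊆ S⊆T nc X Y X∈ Y∈ = nc X Y (S⊆T X∈) (S⊆T Y∈)

AllPairs-∈ : ∀ {A : Set} {R : A → A → Set} {xs x y}
           → AllPairs R xs → x ∈L xs → y ∈L xs → x ≡ y ⊎ R x y ⊎ R y x
AllPairs-∈ (_ ∷ _)    (here refl) (here refl) = inj₁ refl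
AllPairs-∈ (Rx ∷ _)   (here refl) (there y∈)  = inj₂ (inj₁ (All.lookup Rx y∈))
AllPairs-∈ (Rx ∷ _)   (there x∈)  (here refl) = inj₂ (inj₂ (All.lookup Rx x∈))
AllPairs-∈ (_ ∷ pairs) (there x∈) (there y∈)  = AllPairs-∈ pairs x∈ y∈

cyclic : ∀ {k} → ℕ → Fin (suc k)
cyclic zero    = zero
cyclic (suc d) = nextF (cyclic d)

toℕ-nextF : ∀ {k} (i : Fin (suc k)) → toℕ i < k → toℕ (nextF i) ≡ suc (toℕ i)
toℕ-nextF {suc k} zero    _         = refl
toℕ-nextF {suc k} (suc i) (s≤s i<k) with nextF {k} i | toℕ-nextF i i<k
... | suc j | eq = cong suc eq

nextF-last : ∀ {k} (i : Fin (suc k)) → toℕ i ≡ k → nextF i ≡ zero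
nextF-last {zero}  zero    _  = refl
nextF-last {suc k} (suc i) eq with nextF {k} i | nextF-last i (ℕ.suc-injective eq)
... | zero | _ = refl

module _ {k : ℕ} where

  data NextView (i : Fin (suc k)) : Set where
    inner : toℕ i < k → toℕ (nextF i) ≡ suc (toℕ i) → NextView i
    last  : toℕ i ≡ k → nextF i ≡ zero → NextView i

  nextView : (i : Fin (suc k)) → NextView i
  nextView i with ℕ.m≤n⇒m<n∨m≡n (Fin.toℕ≤pred[n] i)
  ... | inj₁ i<k = inner i<k (toℕ-nextF i i<k)
  ... | inj₂ i≡k = last i≡k (nextF-last i i≡k)

  nextF-injective : ∀ {i j : Fin (suc k)} → nextF i ≡ nextF j → i ≡ j
  nextF-injective {i} {j} eq with nextView i | nextView j
  ... | inner _ si | inner _ sj = Fin.toℕ-injective (ℕ.suc-injective (trans (sym si) (trans (cong toℕ eq) sj)))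
  ... | inner _ si | last _ zj  = case (trans (sym si) (cong toℕ (trans eq zj))) of λ ()
  ... | last _ zi  | inner _ sj = case (trans (sym sj) (cong toℕ (trans (sym eq) zi))) of λ ()
  ... | last ik _  | last jk _  = Fin.toℕ-injective (trans ik (sym jk))

  toℕ-cyclic : ∀ {d} → d ≤ k → toℕ (cyclic {k} d) ≡ d
  toℕ-cyclic {zero}  _   = refl
  toℕ-cyclic {suc d} d<k = trans (toℕ-nextF (cyclic d) (subst (_< k) (sym ih) d<k)) (cong suc ih)
    where
    ih : toℕ (cyclic {k} d) ≡ d
    ih = toℕ-cyclic (ℕ.<⇒≤ d<k)

  cyclic-wrap : cyclic {k} (suc k) ≡ zero
  cyclic-wrap = nextF-last (cyclic k) (toℕ-cyclic ℕ.≤-refl)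

  cyclic-toℕ : ∀ {i : Fin (suc k)} {d} → toℕ i ≡ d → cyclic d ≡ i
  cyclic-toℕ {i} refl = Fin.toℕ-injective (toℕ-cyclic (Fin.toℕ≤pred[n] i))

module _ {m : ℕ} {Q : Pred (Fin m) 0ℓ} (Q? : Decidable Q) where

  subset : Subset m
  subset = tabulate (λ e → does (Q? e))

  ∈-subset⁺ : ∀ {e} → Q e → e ∈ subset
  ∈-subset⁺ {e} q = lookup⇒[]= e subset (trans (lookup∘tabulate _ e) (dec-true (Q? e) q))

  ∈-subset⁻ : ∀ {e} → e ∈ subset → Q e
  ∈-subset⁻ {e} e∈ with Q? e | trans (sym (lookup∘tabulate (λ e → does (Q? e)) e)) ([]=⇒lookup e∈)
  ... | yes q | _ = q

⊥-from-< : ∀ {x y} {A : Set} → x < y → x ≡ y → A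
⊥-from-< x<y x≡y = ⊥-elim (ℕ.<⇒≢ x<y x≡y)

<-pred : ∀ {x y} → x < y → ∃ λ y′ → y ≡ suc y′ × x ≤ y′
<-pred {y = suc y′} (s≤s x≤y′) = y′ , refl , x≤y′

Inside : ℕ → ℕ → ℕ → Set
Inside l r x = l ≤ x × x ≤ r

Outside : ℕ → ℕ → ℕ → Set
Outside l r x = x < l ⊎ r < x

inside? : ∀ l r x → Dec (Inside l r x)
inside? l r x = (l ≤? x) ×-dec (x ≤? r)

Inside⇒≢Outside : ∀ {l r x y} → Inside l r x → Outside l r y → x ≢ y
Inside⇒≢Outside (l≤x , _) (inj₁ x<l) refl = ℕ.<-irrefl refl (ℕ.<-≤-trans x<l l≤x)
Inside⇒≢Outside (_ , x≤r) (inj₂ r<x) refl = ℕ.<-irrefl refl (ℕ.≤-<-trans x≤r r<x)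

¬Inside⇒Outside : ∀ {l r x} → ¬ Inside l r x → Outside l r x
¬Inside⇒Outside {l} {r} {x} ¬in with l ≤? x | x ≤? r
... | no l≰x | _      = inj₁ (ℕ.≰⇒> l≰x)
... | yes _  | no x≰r = inj₂ (ℕ.≰⇒> x≰r)
... | yes l≤x | yes x≤r = ⊥-elim (¬in (l≤x , x≤r))

module _ {k : ℕ} {l r : ℕ} where

  entering : ∀ {i j : Fin (suc k)} → nextF j ≡ i → Inside l r (toℕ i) → Outside l r (toℕ j) → toℕ i ≡ l
  entering {j = j} refl (l≤i , i≤r) j-out with nextView j | j-out
  ... | inner _ sj | inj₁ j<l = ℕ.≤-antisym (subst (_≤ l) (sym sj) j<l) l≤i
  ... | inner _ sj | inj₂ r<j =
    ⊥-elim (ℕ.<-irrefl refl (ℕ.<-≤-trans (ℕ.<-trans r<j (ℕ.n<1+n _)) (subst (_≤ r) sj i≤r)))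
  ... | last _ zj  | _        = ℕ.≤-antisym (subst (_≤ l) (sym (cong toℕ zj)) z≤n) l≤i

  leaving : ∀ {i j : Fin (suc k)} → r ≤ k → nextF i ≡ j
          → Inside l r (toℕ i) → Outside l r (toℕ j) → j ≡ cyclic (suc r)
  leaving {i} r≤k refl (l≤i , i≤r) j-out = cong nextF (sym (cyclic-toℕ (i≡r (nextView i) j-out)))
    where
    i≡r : NextView i → Outside l r (toℕ (nextF i)) → toℕ i ≡ r
    i≡r (last i≡k _)  _          = ℕ.≤-antisym i≤r (subst (r ≤_) (sym i≡k) r≤k)
    i≡r (inner _ si) (inj₁ j<l) =
      ⊥-elim (ℕ.<-irrefl refl (ℕ.<-≤-trans (subst (_< l) si j<l) (ℕ.≤-trans l≤i (ℕ.n≤1+n _))))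
    i≡r (inner _ si) (inj₂ r<j) = ℕ.≤-antisym i≤r (ℕ.≤-pred (subst (r <_) si r<j))

-- The complement of the interval [lo, hi] also contains at least two petals.
record Interval (k : ℕ) : Set where
  constructor interval
  field
    lo hi : ℕ
    lo≤hi : lo ≤ hi
    hi≤k  : hi ≤ k
    lo≡0⇒ : lo ≡ 0 → 2 + hi ≤ k
    hi≡k⇒ : hi ≡ k → 2 ≤ lo

module _ {k : ℕ} where
  open Interval

  before : ℕ → Fin (suc k)
  before zero    = cyclic k
  before (suc l) = cyclic l

  nextF-before : ∀ l → nextF (before l) ≡ cyclic l
  nextF-before zero    = cyclic-wrap
  nextF-before (suc l) = refl

  lo-inside : (I : Interval k) → Inside (lo I) (hi I) (toℕ (cyclic {k} (lo I)))
  lo-inside I = subst (Inside _ _) (sym (toℕ-cyclic (ℕ.≤-trans (lo≤hi I) (hi≤k I)))) (ℕ.≤-refl , lo≤hi I)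

  before-outside : (I : Interval k) → Outside (lo I) (hi I) (toℕ (before (lo I)))
  before-outside (interval zero r _ _ lo≡0⇒ _) =
    inj₂ (subst (r <_) (sym (toℕ-cyclic ℕ.≤-refl)) (ℕ.<-trans (ℕ.n<1+n r) (lo≡0⇒ refl)))
  before-outside (interval (suc l) r l<r r≤k _ _) =
    inj₁ (subst (_< suc l) (sym (toℕ-cyclic (ℕ.<⇒≤ (ℕ.<-≤-trans l<r r≤k)))) (ℕ.n<1+n l))

  after-outside : (I : Interval k) → Outside (lo I) (hi I) (toℕ (cyclic {k} (suc (hi I))))
  after-outside I with ℕ.m≤n⇒m<n∨m≡n (hi≤k I)
  ... | inj₁ hi<k = inj₂ (subst (hi I <_) (sym (toℕ-cyclic hi<k)) (ℕ.n<1+n (hi I)))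
  ... | inj₂ refl = inj₁ (subst (_< lo I) (sym (cong toℕ cyclic-wrap)) (ℕ.<-≤-trans (s≤s z≤n) (hi≡k⇒ I refl)))

  before≢after : (I : Interval k) → toℕ (before (lo I)) ≢ toℕ (cyclic {k} (suc (hi I)))
  before≢after (interval zero r _ _ lo≡0⇒ _) eq =
    ℕ.<-irrefl (trans (sym (toℕ-cyclic 1+r≤k)) (trans (sym eq) (toℕ-cyclic ℕ.≤-refl))) (lo≡0⇒ refl)
    where
    1+r≤k : suc r ≤ k
    1+r≤k = ℕ.<⇒≤ (lo≡0⇒ refl)
  before≢after (interval (suc l) r l<r r≤k _ hi≡k⇒) eq with ℕ.m≤n⇒m<n∨m≡n r≤k
  ... | inj₁ r<k = ℕ.<-irrefl (trans (sym before≡l) (trans eq (toℕ-cyclic r<k))) (ℕ.<-trans l<r (ℕ.n<1+n r))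
    where
    before≡l : toℕ (cyclic {k} l) ≡ l
    before≡l = toℕ-cyclic (ℕ.<⇒≤ (ℕ.<-≤-trans l<r r≤k))
  ... | inj₂ refl = ℕ.<-irrefl (trans (sym (cong toℕ cyclic-wrap)) (trans (sym eq) before≡l)) (ℕ.≤-pred (hi≡k⇒ refl))
    where
    before≡l : toℕ (cyclic {k} l) ≡ l
    before≡l = toℕ-cyclic (ℕ.<⇒≤ l<r)

module Flower {n m k : ℕ} (G₀ : Graph n m) (P : Fin (suc k) → EdgeSet m) (partition : IsPartition {n} P)
  (u : Fin (suc k) → Fin n) (u-injective : ∀ {i j} → u i ≡ u j → i ≡ j)
  (petals : ∀ i → Connected G₀ (P i) × BoundaryIs G₀ (P i) (u i) (u (nextF i))) where

  petal : Fin m → Fin (suc k)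
  petal e = proj₁ (partition e)

  ∈petal : ∀ e → e ∈ P (petal e)
  ∈petal e = proj₁ (proj₂ (partition e))

  petal-unique : ∀ {e i} → e ∈ P i → i ≡ petal e
  petal-unique {e} {i} = proj₂ (proj₂ (partition e)) i

  pos : Fin m → ℕ
  pos e = toℕ (petal e)

  pos-petal : ∀ {e i} → e ∈ P i → pos e ≡ toℕ i
  pos-petal e∈ = cong toℕ (sym (petal-unique e∈))

  ∈cyclic-petal : ∀ {e d} → pos e ≡ d → e ∈ P (cyclic d)
  ∈cyclic-petal {e} pos≡d = subst (λ i → e ∈ P i) (sym (cyclic-toℕ pos≡d)) (∈petal e)

  petals-disjoint : ∀ {e e′ i j} → e ∈ P i → e′ ∈ P j → toℕ i ≢ toℕ j → e ≢ e′
  petals-disjoint e∈ e′∈ i≢j refl = i≢j (trans (sym (pos-petal e∈)) (pos-petal e′∈))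

  u∈petal : ∀ i → InV G₀ (P i) (u i)
  u∈petal i = proj₁ (proj₂ (proj₂ (proj₂ (petals i)) (u i)) (inj₁ refl))

  u-next∈petal : ∀ i → InV G₀ (P i) (u (nextF i))
  u-next∈petal i = proj₁ (proj₂ (proj₂ (proj₂ (petals i)) (u (nextF i))) (inj₂ refl))

  InB-petal : ∀ {i v} → InB G₀ (P i) v → v ≡ u i ⊎ v ≡ u (nextF i)
  InB-petal {i} {v} = proj₁ (proj₂ (proj₂ (petals i)) v)

  ∣∣≥2-from-petals : ∀ {X i j} → toℕ i ≢ toℕ j → P i ⊆ X → P j ⊆ X → ∣ X ∣ ≥ 2
  ∣∣≥2-from-petals {i = i} {j} i≢j Pi⊆X Pj⊆X with u∈petal i | u∈petal j
  ... | e , e∈ , _ | e′ , e′∈ , _ =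
    two-members⇒∣∣≥2 (petals-disjoint e∈ e′∈ i≢j) (Pi⊆X e∈) (Pj⊆X e′∈)

  -- Opaque so that the bounds l and r can be inferred from arc l r.
  opaque
    arc : ℕ → ℕ → EdgeSet m
    arc l r = subset (λ e → inside? l r (pos e))

    ∈arc⁺ : ∀ {l r e} → Inside l r (pos e) → e ∈ arc l r
    ∈arc⁺ {l} {r} = ∈-subset⁺ (λ e → inside? l r (pos e))

    ∈arc⁻ : ∀ {l r e} → e ∈ arc l r → Inside l r (pos e)
    ∈arc⁻ {l} {r} = ∈-subset⁻ (λ e → inside? l r (pos e))

  ∈∁arc⁺ : ∀ {l r e} → Outside l r (pos e) → e ∈ ∁ (arc l r)
  ∈∁arc⁺ out = x∉p⇒x∈∁p (λ e∈ → Inside⇒≢Outside (∈arc⁻ e∈) out refl)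

  ∈∁arc⁻ : ∀ {l r e} → e ∈ ∁ (arc l r) → Outside l r (pos e)
  ∈∁arc⁻ e∈ = ¬Inside⇒Outside (λ e-in → x∈∁p⇒x∉p e∈ (∈arc⁺ e-in))

  petal⊆arc : ∀ {l r i} → Inside l r (toℕ i) → P i ⊆ arc l r
  petal⊆arc i-in e∈ = ∈arc⁺ (subst (Inside _ _) (sym (pos-petal e∈)) i-in)

  petal⊆∁arc : ∀ {l r i} → Outside l r (toℕ i) → P i ⊆ ∁ (arc l r)
  petal⊆∁arc i-out e∈ = ∈∁arc⁺ (subst (Outside _ _) (sym (pos-petal e∈)) i-out)

  cyclic-petal⊆arc : ∀ {l r d} → Inside l r d → d ≤ k → P (cyclic d) ⊆ arc l r
  cyclic-petal⊆arc d-in d≤k = petal⊆arc (subst (Inside _ _) (sym (toℕ-cyclic d≤k)) d-in)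

  u-lo∈arc : ∀ {l r} → l ≤ r → r ≤ k → InV G₀ (arc l r) (u (cyclic l))
  u-lo∈arc l≤r r≤k = InV-mono (cyclic-petal⊆arc (ℕ.≤-refl , l≤r) (ℕ.≤-trans l≤r r≤k)) (u∈petal _)

  u-hi∈arc : ∀ {l r} → l ≤ r → r ≤ k → InV G₀ (arc l r) (u (cyclic (suc r)))
  u-hi∈arc l≤r r≤k = InV-mono (cyclic-petal⊆arc (l≤r , ℕ.≤-refl) r≤k) (u-next∈petal _)

  arc-connected : ∀ {l r} → l ≤ r → r ≤ k → Connected G₀ (arc l r)
  arc-connected {l} l≤r r≤k with ℕ.m≤n⇒m<n∨m≡n l≤r
  ... | inj₂ refl = Connected-cong (cyclic-petal⊆arc (ℕ.≤-refl , ℕ.≤-refl) r≤k)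
                      (λ e∈ → ∈cyclic-petal (ℕ.≤-antisym (proj₂ (∈arc⁻ e∈)) (proj₁ (∈arc⁻ e∈))))
                      (proj₁ (petals (cyclic l)))
  ... | inj₁ (s≤s {n = r} l≤r′) =
    Connected-∪ (u (cyclic (suc r))) (arc-connected l≤r′ r≤k′) (proj₁ (petals (cyclic (suc r))))
      (λ e∈ → let l≤e , e≤r = ∈arc⁻ e∈ in ∈arc⁺ (l≤e , ℕ.m≤n⇒m≤1+n e≤r))
      (cyclic-petal⊆arc (ℕ.m≤n⇒m≤1+n l≤r′ , ℕ.≤-refl) r≤k)
      split (u-hi∈arc l≤r′ r≤k′) (u∈petal _)
    where
    r≤k′ : r ≤ k
    r≤k′ = ℕ.≤-trans (ℕ.n≤1+n r) r≤k
    split : ∀ {e} → e ∈ arc l (suc r) → e ∈ arc l r ⊎ e ∈ P (cyclic (suc r))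
    split e∈ with ∈arc⁻ e∈
    ... | l≤e , e≤1+r with ℕ.m≤n⇒m<n∨m≡n e≤1+r
    ...   | inj₁ e<1+r  = inj₁ (∈arc⁺ (l≤e , ℕ.≤-pred e<1+r))
    ...   | inj₂ e≡1+r  = inj₂ (∈cyclic-petal e≡1+r)

  pos≤k : ∀ e → pos e ≤ k
  pos≤k e = Fin.toℕ≤pred[n] (petal e)

  ∁arc-connected : (I : Interval k) → Connected G₀ (∁ (arc (Interval.lo I) (Interval.hi I)))
  ∁arc-connected (interval zero r _ _ lo≡0⇒ _) =
    Connected-cong tail⊆∁arc ∁arc⊆tail (arc-connected (ℕ.<⇒≤ (lo≡0⇒ refl)) ℕ.≤-refl)
    where
    tail⊆∁arc : arc (suc r) k ⊆ ∁ (arc 0 r)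
    tail⊆∁arc e∈ = ∈∁arc⁺ (inj₂ (proj₁ (∈arc⁻ e∈)))
    ∁arc⊆tail : ∁ (arc 0 r) ⊆ arc (suc r) k
    ∁arc⊆tail {e} e∈ with ∈∁arc⁻ e∈
    ... | inj₂ r<e = ∈arc⁺ (r<e , pos≤k e)
  ∁arc-connected (interval (suc l) r l<r r≤k _ _) with ℕ.m≤n⇒m<n∨m≡n r≤k
  ... | inj₂ refl = Connected-cong head⊆∁arc ∁arc⊆head (arc-connected z≤n l≤k)
    where
    l≤k : l ≤ k
    l≤k = ℕ.<⇒≤ l<r
    head⊆∁arc : arc 0 l ⊆ ∁ (arc (suc l) k)
    head⊆∁arc e∈ = ∈∁arc⁺ (inj₁ (s≤s (proj₂ (∈arc⁻ e∈))))
    ∁arc⊆head : ∁ (arc (suc l) k) ⊆ arc 0 l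
    ∁arc⊆head {e} e∈ with ∈∁arc⁻ e∈
    ... | inj₁ e<l+1 = ∈arc⁺ (z≤n , ℕ.≤-pred e<l+1)
    ... | inj₂ k<e   = ⊥-elim (ℕ.<-irrefl refl (ℕ.<-≤-trans k<e (pos≤k e)))
  ... | inj₁ r<k =
    Connected-∪ (u zero) (arc-connected r<k ℕ.≤-refl) (arc-connected z≤n l≤k)
      tail⊆∁arc head⊆∁arc ∁arc⊆tail∪head
      (subst (λ i → InV G₀ (arc (suc r) k) (u i)) cyclic-wrap (u-hi∈arc r<k ℕ.≤-refl)) (u-lo∈arc z≤n l≤k)
    where
    l≤k : l ≤ k
    l≤k = ℕ.<⇒≤ (ℕ.<-≤-trans l<r r≤k)
    tail⊆∁arc : arc (suc r) k ⊆ ∁ (arc (suc l) r)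
    tail⊆∁arc e∈ = ∈∁arc⁺ (inj₂ (proj₁ (∈arc⁻ e∈)))
    head⊆∁arc : arc 0 l ⊆ ∁ (arc (suc l) r)
    head⊆∁arc e∈ = ∈∁arc⁺ (inj₁ (s≤s (proj₂ (∈arc⁻ e∈))))
    ∁arc⊆tail∪head : ∀ {e} → e ∈ ∁ (arc (suc l) r) → e ∈ arc (suc r) k ⊎ e ∈ arc 0 l
    ∁arc⊆tail∪head {e} e∈ with ∈∁arc⁻ e∈
    ... | inj₁ e<l+1 = inj₂ (∈arc⁺ (z≤n , ℕ.≤-pred e<l+1))
    ... | inj₂ r<e   = inj₁ (∈arc⁺ (r<e , pos≤k e))

  shared-end : ∀ {e e′ v} → pos e ≢ pos e′ → IsEnd G₀ e v → IsEnd G₀ e′ v → InB G₀ (P (petal e)) v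
  shared-end {e} {e′} ne end end′ =
    (e , ∈petal e , end) , (e′ , x∉p⇒x∈∁p (λ e′∈ → ne (sym (pos-petal e′∈))) , end′)

  arc-union : ∀ l r → UnionOfPetals {n} P (arc l r)
  arc-union l r i with inside? l r (toℕ i)
  ... | yes i-in = inj₁ λ _ → petal⊆arc i-in
  ... | no i-out = inj₂ λ _ e∈ → x∈∁p⇒x∉p (petal⊆∁arc (¬Inside⇒Outside i-out) e∈)

  module _ (I : Interval k) where
    open Interval I

    α β : Fin n
    α = u (cyclic lo)
    β = u (cyclic (suc hi))

    arc-size : lo < hi → ∣ arc lo hi ∣ ≥ 2
    arc-size lo<hi = ∣∣≥2-from-petals lo≢1+lo (cyclic-petal⊆arc (ℕ.≤-refl , lo≤hi) lo≤k)
                                              (cyclic-petal⊆arc (ℕ.n≤1+n lo , lo<hi) (ℕ.≤-trans lo<hi hi≤k))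
      where
      lo≤k : lo ≤ k
      lo≤k = ℕ.≤-trans lo≤hi hi≤k
      lo≢1+lo : toℕ (cyclic {k} lo) ≢ toℕ (cyclic {k} (suc lo))
      lo≢1+lo eq =
        ℕ.<-irrefl (trans (sym (toℕ-cyclic lo≤k)) (trans eq (toℕ-cyclic (ℕ.≤-trans lo<hi hi≤k)))) (ℕ.n<1+n lo)

    ∁arc-size : ∣ ∁ (arc lo hi) ∣ ≥ 2
    ∁arc-size = ∣∣≥2-from-petals (before≢after I) (petal⊆∁arc (before-outside I)) (petal⊆∁arc (after-outside I))

    α≢β : α ≢ β
    α≢β eq = Inside⇒≢Outside (lo-inside I) (after-outside I) (cong toℕ (u-injective eq))

    α∈∂arc : InB G₀ (arc lo hi) α
    α∈∂arc = u-lo∈arc lo≤hi hi≤k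
           , subst (λ i → InV G₀ (∁ (arc lo hi)) (u i)) (nextF-before lo)
                   (InV-mono (petal⊆∁arc (before-outside I)) (u-next∈petal (before lo)))

    β∈∂arc : InB G₀ (arc lo hi) β
    β∈∂arc = u-hi∈arc lo≤hi hi≤k , InV-mono (petal⊆∁arc (after-outside I)) (u∈petal _)

    -- A vertex on both sides is an end of a petal inside the arc and of one outside it,
    -- so it is where the cyclic order of petals enters or leaves the arc.
    ∂arc⊆αβ : ∀ {v} → InB G₀ (arc lo hi) v → v ≡ α ⊎ v ≡ β
    ∂arc⊆αβ {v} ((e , e∈ , end) , (e′ , e′∈ , end′)) =
      cases (InB-petal (shared-end i≢j end end′)) (InB-petal (shared-end (≢-sym i≢j) end′ end))
      where
      i j : Fin (suc k)
      i = petal e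
      j = petal e′
      i-in : Inside lo hi (toℕ i)
      i-in = ∈arc⁻ e∈
      j-out : Outside lo hi (toℕ j)
      j-out = ∈∁arc⁻ e′∈
      i≢j : toℕ i ≢ toℕ j
      i≢j = Inside⇒≢Outside i-in j-out
      cases : v ≡ u i ⊎ v ≡ u (nextF i) → v ≡ u j ⊎ v ≡ u (nextF j) → v ≡ α ⊎ v ≡ β
      cases (inj₁ v≡ui)  (inj₁ v≡uj)  = ⊥-elim (i≢j (cong toℕ (u-injective (trans (sym v≡ui) v≡uj))))
      cases (inj₂ v≡u+i) (inj₂ v≡u+j) =
        ⊥-elim (i≢j (cong toℕ (nextF-injective (u-injective (trans (sym v≡u+i) v≡u+j)))))
      cases (inj₁ v≡ui)  (inj₂ v≡u+j) =
        inj₁ (trans v≡ui (cong u (sym (cyclic-toℕ (entering (u-injective (trans (sym v≡u+j) v≡ui)) i-in j-out)))))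
      cases (inj₂ v≡u+i) (inj₁ v≡uj)  =
        inj₂ (trans v≡uj (cong u (leaving hi≤k (u-injective (trans (sym v≡u+i) v≡uj)) i-in j-out)))

    σ : Fin n → Fin n
    σ = swap {m = m} α β

    arc-splits : SplitsAt G₀ (arc lo hi) α β
    arc-splits = (α≢β , λ v → ∂arc⊆αβ , λ { (inj₁ refl) → α∈∂arc ; (inj₂ refl) → β∈∂arc })
               , arc-connected lo≤hi hi≤k , ∁arc-connected I

  open Interval

  arcOf : Interval k → EdgeSet m
  arcOf I = arc (lo I) (hi I)

  _≺_ : Interval k → Interval k → Set
  I ≺ J = hi I < lo J

  ≺-trans : ∀ {I J K} → I ≺ J → J ≺ K → I ≺ K
  ≺-trans {J = J} I≺J J≺K = ℕ.<-trans I≺J (ℕ.≤-<-trans (lo≤hi J) J≺K)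

  ≺⇒disjoint : ∀ {I J e} → I ≺ J → e ∈ arcOf I → e ∉ arcOf J
  ≺⇒disjoint I≺J e∈I e∈J =
    ℕ.<-irrefl refl (ℕ.≤-<-trans (proj₂ (∈arc⁻ e∈I)) (ℕ.<-≤-trans I≺J (proj₁ (∈arc⁻ e∈J))))

  data Arranged (G : Graph n m) (I : Interval k) : Set where
    kept    : lo I ≡ hi I → (∀ {e} → e ∈ arcOf I → G e ≡ G₀ e) → Arranged G I
    flipped : lo I < hi I → (∀ {e} → e ∈ arcOf I → G e ≡ mapEnds (σ I) (G₀ e)) → Arranged G I

  Arranged-cong : ∀ {G G′ I} → (∀ {e} → e ∈ arcOf I → G′ e ≡ G e) → Arranged G I → Arranged G′ I
  Arranged-cong G′≡G (kept lo≡hi same)       = kept lo≡hi (λ e∈ → trans (G′≡G e∈) (same e∈))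
  Arranged-cong G′≡G (flipped lo<hi swapped) = flipped lo<hi (λ e∈ → trans (G′≡G e∈) (swapped e∈))

  record Arrangement (D : List (Interval k)) (G : Graph n m) : Set where
    field
      arranged  : ∀ {I} → I ∈L D → Arranged G I
      untouched : ∀ {e} → (∀ {I} → I ∈L D → e ∉ arcOf I) → G e ≡ G₀ e
  open Arrangement

  module Block {G : Graph n m} (I : Interval k)
    (swapped : ∀ {e} → e ∈ arcOf I → G e ≡ mapEnds (σ I) (G₀ e)) =
    SwappedBlock G₀ G (arc-connected (lo≤hi I) (hi≤k I)) (α≢β I) (proj₁ (α∈∂arc I)) (proj₁ (β∈∂arc I)) swapped

  data EdgeState (G : Graph n m) (D : List (Interval k)) (e : Fin m) : Set where
    unmoved : G e ≡ G₀ e → EdgeState G D e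
    moved   : ∀ {I} → I ∈L D → e ∈ arcOf I
            → (∀ {e} → e ∈ arcOf I → G e ≡ mapEnds (σ I) (G₀ e)) → EdgeState G D e

  edgeState : ∀ {D G} → Arrangement D G → ∀ e → EdgeState G D e
  edgeState {D} arr e with any? (λ I → e ∈? arcOf I) D
  ... | no ∉arcs = unmoved (untouched arr (λ I∈ e∈ → ∉arcs (lose I∈ e∈)))
  ... | yes ∈arcs with find ∈arcs
  ...   | I , I∈ , e∈ with arranged arr I∈
  ...     | kept _ same       = unmoved (same e∈)
  ...     | flipped _ swapped = moved I∈ e∈ swapped

  module _ {D G} (arr : Arrangement D G) {X : EdgeSet m} (D⊆∁X : ∀ {I} → I ∈L D → arcOf I ⊆ ∁ X) where

    ∁-walk : ∀ {e} → e ∉ X → Walk G (∁ X) (proj₁ (G₀ e)) (proj₂ (G₀ e))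
    ∁-walk {e} e∉X with edgeState arr e
    ... | unmoved eq               = subst₂ (Walk G (∁ X)) (cong proj₁ eq) (cong proj₂ eq) (edgeʷ e (x∉p⇒x∈∁p e∉X))
    ... | moved {I} I∈ e∈ swapped  = Block.unswapped-edge I swapped (D⊆∁X I∈) e∈

    ∁-InV⁻ : ∀ {v} → InV G (∁ X) v → InV G₀ (∁ X) v
    ∁-InV⁻ (e , e∈ , end) with edgeState arr e
    ... | unmoved eq               = e , e∈ , IsEnd-map {G₀ = G} {G₀} id (sym eq) end
    ... | moved {I} I∈ e∈I swapped  = InV-mono (D⊆∁X I∈) (Block.InV-unswap I swapped (e , e∈I , end))

    ∁-InV⁺ : ∀ {v} → InV G₀ (∁ X) v → InV G (∁ X) v
    ∁-InV⁺ (e , e∈ , end) with edgeState arr e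
    ... | unmoved eq               = e , e∈ , IsEnd-map {G₀ = G₀} {G} id eq end
    ... | moved {I} I∈ e∈I swapped  = InV-mono (D⊆∁X I∈) (Block.InV-swap I swapped (e , e∈I , end))

  ∅-arrangement : Arrangement [] G₀
  ∅-arrangement = record { arranged = λ () ; untouched = λ _ → refl }

  module _ {D G} (I : Interval k) (arr : Arrangement D G) (I≺D : ∀ {J} → J ∈L D → I ≺ J) where

    private
      D⊆∁arc : ∀ {J} → J ∈L D → arcOf J ⊆ ∁ (arcOf I)
      D⊆∁arc {J} J∈ e∈J = x∉p⇒x∈∁p (λ e∈I → ≺⇒disjoint {I} {J} (I≺D J∈) e∈I e∈J)

      fresh : ∀ {e} → e ∈ arcOf I → G e ≡ G₀ e
      fresh e∈I = untouched arr (λ {J} J∈ → ≺⇒disjoint {I} {J} (I≺D J∈) e∈I)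

    keep : lo I ≡ hi I → Arrangement (I ∷ D) G
    keep lo≡hi = record
      { arranged  = λ { (here refl) → kept lo≡hi fresh ; (there J∈) → arranged arr J∈ }
      ; untouched = λ ∉arcs → untouched arr (λ J∈ → ∉arcs (there J∈)) }

    arc-splits-now : SplitsAt G (arcOf I) (α I) (β I)
    arc-splits-now =
      SplitsAt-transfer fresh (∁-walk arr D⊆∁arc) (∁-InV⁻ arr D⊆∁arc) (∁-InV⁺ arr D⊆∁arc) (arc-splits I)

    arc-twoSep : lo I < hi I → TwoSepOf G P (arcOf I)
    arc-twoSep lo<hi = SplitsAt⇒TwoSep (arc-size I lo<hi) (∁arc-size I) arc-splits-now , arc-union (lo I) (hi I)

    flip : lo I < hi I → Arrangement (I ∷ D) (whitneyFlip G (arcOf I) (α I) (β I))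
    flip lo<hi = record { arranged = arranged′ ; untouched = untouched′ }
      where
      G′ : Graph n m
      G′ = whitneyFlip G (arcOf I) (α I) (β I)
      arranged′ : ∀ {J} → J ∈L I ∷ D → Arranged G′ J
      arranged′ (here refl) = flipped lo<hi (λ e∈ → trans (whitneyFlip-∈ e∈) (cong (mapEnds (σ I)) (fresh e∈)))
      arranged′ (there J∈)  = Arranged-cong (λ e∈J → whitneyFlip-∉ (x∈∁p⇒x∉p (D⊆∁arc J∈ e∈J))) (arranged arr J∈)
      untouched′ : ∀ {e} → (∀ {J} → J ∈L I ∷ D → e ∉ arcOf J) → G′ e ≡ G₀ e
      untouched′ ∉arcs = trans (whitneyFlip-∉ (∉arcs (here refl))) (untouched arr (λ J∈ → ∉arcs (there J∈)))

  Realisation : List (Interval k) → Set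
  Realisation D = ∃ λ S → ∃ λ H → WSeq P G₀ S H × S ⊆L map arcOf D × Arrangement D H

  extend : ∀ {D} I → (∀ {J} → J ∈L D → I ≺ J) → Realisation D → Realisation (I ∷ D)
  extend I I≺D (S , H , ws , S⊆D , arr) with ℕ.m≤n⇒m<n∨m≡n (lo≤hi I)
  ... | inj₂ lo≡hi = S , H , ws , (λ X∈ → there (S⊆D X∈)) , keep I arr I≺D lo≡hi
  ... | inj₁ lo<hi =
    S ∷ʳ arcOf I , whitneyFlip H (arcOf I) (α I) (β I)
    , WSeq-snoc ws (arc-twoSep I arr I≺D lo<hi) (Flip-whitneyFlip {G = H} {arcOf I} (proj₁ (arc-splits-now I arr I≺D)))
    , S∷ʳI⊆ , flip I arr I≺D lo<hi
    where
    S∷ʳI⊆ : S ∷ʳ arcOf I ⊆L map arcOf (I ∷ _)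
    S∷ʳI⊆ X∈ with ∈-++⁻ S X∈
    ... | inj₁ X∈S         = there (S⊆D X∈S)
    ... | inj₂ (here refl) = here refl

  realise : ∀ D → AllPairs _≺_ D → Realisation D
  realise []      []            = [] , G₀ , wnil , (λ ()) , ∅-arrangement
  realise (I ∷ D) (I≺D ∷ pairs) = extend I (All.lookup I≺D) (realise D pairs)

  arcs-nonCrossing : ∀ {D} → AllPairs _≺_ D → NonCrossing (map arcOf D)
  arcs-nonCrossing pairs X Y X∈ Y∈ (X∩Y , X-Y , _ , _) with ∈-map⁻ arcOf X∈ | ∈-map⁻ arcOf Y∈
  ... | I , I∈ , refl | J , J∈ , refl with AllPairs-∈ pairs I∈ J∈
  ...   | inj₁ refl        = let e∈I , e∈∁I = x∈p∩q⁻ _ _ (proj₂ X-Y) in x∈∁p⇒x∉p e∈∁I e∈I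
  ...   | inj₂ (inj₁ I≺J) = let e∈I , e∈J = x∈p∩q⁻ _ _ (proj₂ X∩Y) in ≺⇒disjoint {I} {J} I≺J e∈I e∈J
  ...   | inj₂ (inj₂ J≺I) = let e∈I , e∈J = x∈p∩q⁻ _ _ (proj₂ X∩Y) in ≺⇒disjoint {J} {I} J≺I e∈J e∈I

  lo-petal⊆arc : ∀ I → P (cyclic (lo I)) ⊆ arcOf I
  lo-petal⊆arc I = cyclic-petal⊆arc (ℕ.≤-refl , lo≤hi I) (ℕ.≤-trans (lo≤hi I) (hi≤k I))

  hi-petal⊆arc : ∀ I → P (cyclic (hi I)) ⊆ arcOf I
  hi-petal⊆arc I = cyclic-petal⊆arc (lo≤hi I , ℕ.≤-refl) (hi≤k I)

  lo-petal∋β : ∀ {H I} → Arranged H I → InV H (P (cyclic (lo I))) (β I)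
  lo-petal∋β {H} {I} (kept lo≡hi same) =
    subst (λ r → InV H (P (cyclic (lo I))) (u (cyclic (suc r)))) lo≡hi
          (InV-map id (λ e∈ → same (lo-petal⊆arc I e∈)) (u-next∈petal _))
  lo-petal∋β {H} {I} (flipped _ swapped) =
    subst (InV H _) (swap-first {m = m} (α I) (β I)) (InV-map (σ I) (λ e∈ → swapped (lo-petal⊆arc I e∈)) (u∈petal _))

  hi-petal∋α : ∀ {H I} → Arranged H I → InV H (P (cyclic (hi I))) (α I)
  hi-petal∋α {H} {I} (kept lo≡hi same) =
    subst (λ l → InV H (P (cyclic (hi I))) (u (cyclic l))) (sym lo≡hi)
          (InV-map id (λ e∈ → same (hi-petal⊆arc I e∈)) (u∈petal _))
  hi-petal∋α {H} {I} (flipped _ swapped) =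
    subst (InV H _) (swap-second {m = m} (α≢β I))
          (InV-map (σ I) (λ e∈ → swapped (hi-petal⊆arc I e∈)) (u-next∈petal _))

  Shares : Graph n m → Fin (suc k) → Fin (suc k) → Set
  Shares H i j = ∃ λ v → InV H (P i) v × InV H (P j) v

  shares-when-linked : ∀ {D H I J} → Arrangement D H → I ∈L D → J ∈L D → β I ≡ α J
                     → Shares H (cyclic (lo I)) (cyclic (hi J))
  shares-when-linked {H = H} arr I∈ J∈ βI≡αJ =
    _ , lo-petal∋β (arranged arr I∈) , subst (InV H _) (sym βI≡αJ) (hi-petal∋α (arranged arr J∈))

  Solution : Fin (suc k) → Fin (suc k) → Fin (suc k) → Fin (suc k) → Set
  Solution a b c d = ∃ λ S → ∃ λ H → WSeq P G₀ S H × NonCrossing S × Shares H a b × Shares H c d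

  solve : ∀ D {I J I′ J′} → Linked _≺_ D → I ∈L D → J ∈L D → I′ ∈L D → J′ ∈L D
        → β I ≡ α J → β I′ ≡ α J′
        → Solution (cyclic (lo I)) (cyclic (hi J)) (cyclic (lo I′)) (cyclic (hi J′))
  solve D linked I∈ J∈ I′∈ J′∈ linkIJ linkI′J′ =
    let S , H , ws , S⊆D , arr = realise D pairs
    in S , H , ws , NonCrossing-⊆ S⊆D (arcs-nonCrossing pairs)
       , shares-when-linked arr I∈ J∈ linkIJ , shares-when-linked arr I′∈ J′∈ linkI′J′
    where
    pairs : AllPairs _≺_ D
    pairs = Linked⇒AllPairs (λ {I} {J} {K} → ≺-trans {I} {J} {K}) linked

  disjoint-pairs : ∀ {a b c d} → a ≤ b → suc b < c → c ≤ d → suc d ≤ k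
                 → Solution (cyclic a) (cyclic (suc b)) (cyclic c) (cyclic (suc d))
  disjoint-pairs {a} {b} {c} {d} a≤b 1+b<c c≤d 1+d≤k =
    solve (I₁ ∷ I₂ ∷ I₃ ∷ I₄ ∷ []) (ℕ.n<1+n b ∷ 1+b<c ∷ ℕ.n<1+n d ∷ [-])
          (here refl) (there (here refl)) (there (there (here refl))) (there (there (there (here refl)))) refl refl
    where
    1+b<k : suc b < k
    1+b<k = ℕ.<-≤-trans 1+b<c (ℕ.≤-trans c≤d (ℕ.<⇒≤ 1+d≤k))
    I₁ I₂ I₃ I₄ : Interval k
    I₁ = interval a b a≤b (ℕ.<⇒≤ (ℕ.<-trans (ℕ.n<1+n b) 1+b<k)) (λ _ → 1+b<k)
                  (⊥-from-< (ℕ.<-trans (ℕ.n<1+n b) 1+b<k))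
    I₂ = interval (suc b) (suc b) ℕ.≤-refl (ℕ.<⇒≤ 1+b<k) (λ ()) (⊥-from-< 1+b<k)
    I₃ = interval c d c≤d (ℕ.<⇒≤ 1+d≤k) (⊥-from-< (ℕ.≤-trans (s≤s z≤n) 1+b<c) ∘ sym) (⊥-from-< 1+d≤k)
    I₄ = interval (suc d) (suc d) ℕ.≤-refl 1+d≤k (λ ())
                  (λ _ → s≤s (ℕ.≤-trans (s≤s z≤n) (ℕ.≤-trans 1+b<c c≤d)))

  interleaved-pairs : ∀ {a b c d} → a ≤ c → suc c < b → b < d → d ≤ k
                    → Solution (cyclic a) (cyclic b) (cyclic (suc c)) (cyclic d)
  interleaved-pairs {a} {b} {c} {d} a≤c 1+c<b b<d d≤k =
    solve (I₁ ∷ I₂ ∷ I₃ ∷ []) (ℕ.n<1+n c ∷ ℕ.n<1+n b ∷ [-])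
          (here refl) (there (here refl)) (there (here refl)) (there (there (here refl))) refl refl
    where
    b<k : b < k
    b<k = ℕ.<-≤-trans b<d d≤k
    1+c<k : suc c < k
    1+c<k = ℕ.<-trans 1+c<b b<k
    I₁ I₂ I₃ : Interval k
    I₁ = interval a c a≤c (ℕ.<⇒≤ (ℕ.<-trans (ℕ.n<1+n c) 1+c<k)) (λ _ → ℕ.≤-trans 1+c<b (ℕ.<⇒≤ b<k))
                  (⊥-from-< (ℕ.<-trans (ℕ.n<1+n c) 1+c<k))
    I₂ = interval (suc c) b (ℕ.<⇒≤ 1+c<b) (ℕ.<⇒≤ b<k) (λ ()) (⊥-from-< b<k)
    I₃ = interval (suc b) d b<d d≤k (λ ()) (λ _ → s≤s (ℕ.≤-trans (s≤s z≤n) 1+c<b))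

  nested-pairs : ∀ {a b c d} → a < c → c ≤ d → suc d < b → b ≤ k
               → Solution (cyclic b) (cyclic a) (cyclic c) (cyclic (suc d))
  nested-pairs {a} {b} {c} {d} a<c c≤d 1+d<b b≤k =
    solve (I₁ ∷ I₂ ∷ I₃ ∷ I₄ ∷ []) (a<c ∷ ℕ.n<1+n d ∷ 1+d<b ∷ [-])
          (there (there (there (here refl)))) (here refl) (there (here refl)) (there (there (here refl)))
          (cong u cyclic-wrap) refl
    where
    1+d<k : suc d < k
    1+d<k = ℕ.<-≤-trans 1+d<b b≤k
    a<d : a < d
    a<d = ℕ.<-≤-trans a<c c≤d
    I₁ I₂ I₃ I₄ : Interval k
    I₁ = interval 0 a z≤n (ℕ.<⇒≤ (ℕ.<-trans a<d (ℕ.<-trans (ℕ.n<1+n d) 1+d<k)))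
                  (λ _ → ℕ.≤-trans (s≤s a<d) (ℕ.<⇒≤ 1+d<k))
                  (⊥-from-< (ℕ.<-trans a<d (ℕ.<-trans (ℕ.n<1+n d) 1+d<k)))
    I₂ = interval c d c≤d (ℕ.<⇒≤ (ℕ.<-trans (ℕ.n<1+n d) 1+d<k)) (⊥-from-< (ℕ.≤-<-trans z≤n a<c) ∘ sym)
                  (⊥-from-< (ℕ.<-trans (ℕ.n<1+n d) 1+d<k))
    I₃ = interval (suc d) (suc d) ℕ.≤-refl (ℕ.<⇒≤ 1+d<k) (λ ()) (⊥-from-< 1+d<k)
    I₄ = interval b k b≤k ℕ.≤-refl (⊥-from-< (ℕ.≤-<-trans z≤n 1+d<b) ∘ sym)
                  (λ _ → ℕ.≤-trans (s≤s (s≤s z≤n)) 1+d<b)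

  Solution-at : ∀ {a b c d a′ b′ c′ d′} → toℕ a ≡ a′ → toℕ b ≡ b′ → toℕ c ≡ c′ → toℕ d ≡ d′
              → Solution (cyclic a′) (cyclic b′) (cyclic c′) (cyclic d′) → Solution a b c d
  Solution-at a≡ b≡ c≡ d≡ = go (cyclic-toℕ a≡) (cyclic-toℕ b≡) (cyclic-toℕ c≡) (cyclic-toℕ d≡)
    where
    go : ∀ {a b c d a′ b′ c′ d′} → a′ ≡ a → b′ ≡ b → c′ ≡ c → d′ ≡ d
       → Solution a′ b′ c′ d′ → Solution a b c d
    go refl refl refl refl sol = sol

  Solution-swap₁ : ∀ {a b c d} → Solution a b c d → Solution b a c d
  Solution-swap₁ (S , H , ws , nc , (v , a∋v , b∋v) , cd) = S , H , ws , nc , (v , b∋v , a∋v) , cd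

  Solution-swap₂ : ∀ {a b c d} → Solution a b c d → Solution a b d c
  Solution-swap₂ (S , H , ws , nc , ab , (v , c∋v , d∋v)) = S , H , ws , nc , ab , (v , d∋v , c∋v)

  Solution-swap : ∀ {a b c d} → Solution a b c d → Solution c d a b
  Solution-swap (S , H , ws , nc , ab , cd) = S , H , ws , nc , cd , ab

  solution-sorted : ∀ {a b c d} → toℕ a < toℕ b → toℕ c < toℕ d → toℕ a < toℕ c
                  → toℕ b ≢ toℕ c → toℕ b ≢ toℕ d → Solution a b c d
  solution-sorted {a} {b} {c} {d} a<b c<d a<c b≢c b≢d with ℕ.<-cmp (toℕ b) (toℕ c)
  ... | tri≈ _ b≡c _ = ⊥-elim (b≢c b≡c)
  ... | tri< b<c _ _ with <-pred a<b | <-pred c<d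
  ...   | b′ , b≡ , a≤b′ | d′ , d≡ , c≤d′ =
    Solution-at refl b≡ refl d≡
      (disjoint-pairs a≤b′ (subst (_< toℕ c) b≡ b<c) c≤d′ (subst (_≤ k) d≡ (Fin.toℕ≤pred[n] d)))
  solution-sorted {a} {b} {c} {d} a<b c<d a<c b≢c b≢d | tri> _ _ c<b with ℕ.<-cmp (toℕ b) (toℕ d)
  ... | tri≈ _ b≡d _ = ⊥-elim (b≢d b≡d)
  ... | tri< b<d _ _ with <-pred a<c
  ...   | c′ , c≡ , a≤c′ =
    Solution-at refl refl c≡ refl (interleaved-pairs a≤c′ (subst (_< toℕ b) c≡ c<b) b<d (Fin.toℕ≤pred[n] d))
  solution-sorted {a} {b} {c} {d} a<b c<d a<c b≢c b≢d | tri> _ _ c<b | tri> _ _ d<b with <-pred c<d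
  ...   | d′ , d≡ , c≤d′ =
    Solution-swap₁ (Solution-at refl refl refl d≡
      (nested-pairs a<c c≤d′ (subst (_< toℕ b) d≡ d<b) (Fin.toℕ≤pred[n] b)))

  solution-ordered : ∀ {a b c d} → toℕ a < toℕ b → toℕ c < toℕ d
                   → toℕ a ≢ toℕ c → toℕ a ≢ toℕ d → toℕ b ≢ toℕ c → toℕ b ≢ toℕ d → Solution a b c d
  solution-ordered {a} {b} {c} {d} a<b c<d a≢c a≢d b≢c b≢d with ℕ.<-cmp (toℕ a) (toℕ c)
  ... | tri< a<c _ _ = solution-sorted a<b c<d a<c b≢c b≢d
  ... | tri≈ _ a≡c _ = ⊥-elim (a≢c a≡c)
  ... | tri> _ _ c<a = Solution-swap (solution-sorted c<d a<b c<a (≢-sym a≢d) (≢-sym b≢d))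

  solution : ∀ {a b c d} → toℕ a ≢ toℕ b → toℕ a ≢ toℕ c → toℕ a ≢ toℕ d
           → toℕ b ≢ toℕ c → toℕ b ≢ toℕ d → toℕ c ≢ toℕ d → Solution a b c d
  solution {a} {b} {c} {d} a≢b a≢c a≢d b≢c b≢d c≢d with ℕ.<-cmp (toℕ a) (toℕ b) | ℕ.<-cmp (toℕ c) (toℕ d)
  ... | tri≈ _ a≡b _ | _            = ⊥-elim (a≢b a≡b)
  ... | _            | tri≈ _ c≡d _ = ⊥-elim (c≢d c≡d)
  ... | tri< a<b _ _ | tri< c<d _ _ = solution-ordered a<b c<d a≢c a≢d b≢c b≢d
  ... | tri> _ _ b<a | tri< c<d _ _ = Solution-swap₁ (solution-ordered b<a c<d b≢c b≢d a≢c a≢d)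
  ... | tri< a<b _ _ | tri> _ _ d<c = Solution-swap₂ (solution-ordered a<b d<c a≢d a≢c b≢d b≢c)
  ... | tri> _ _ b<a | tri> _ _ d<c = Solution-swap₁ (Solution-swap₂ (solution-ordered b<a d<c b≢d b≢c a≢d a≢c))

lemma4 : ∀ {n m k} (G : Graph n m) (P : Fin (suc k) → EdgeSet m) → IsFlower G P
       → (i₁ i₂ i₃ i₄ : Fin (suc k))
       → i₁ ≢ i₂ → i₁ ≢ i₃ → i₁ ≢ i₄ → i₂ ≢ i₃ → i₂ ≢ i₄ → i₃ ≢ i₄
       → ∃ λ (S : List (EdgeSet m)) → ∃ λ (H : Graph n m)
           → WSeq P G S H × NonCrossing S
             × Consecutive H P i₁ i₂ × Consecutive H P i₃ i₄
lemma4 G P (_ , partition , u , u-injective , petals) i₁ i₂ i₃ i₄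
       i₁≢i₂ i₁≢i₃ i₁≢i₄ i₂≢i₃ i₂≢i₄ i₃≢i₄
  with Flower.solution G P partition u u-injective petals
         (toℕ-≢ i₁≢i₂) (toℕ-≢ i₁≢i₃) (toℕ-≢ i₁≢i₄) (toℕ-≢ i₂≢i₃) (toℕ-≢ i₂≢i₄) (toℕ-≢ i₃≢i₄)
  where
  toℕ-≢ : ∀ {k} {i j : Fin k} → i ≢ j → toℕ i ≢ toℕ j
  toℕ-≢ i≢j = i≢j ∘ Fin.toℕ-injective
... | S , H , wseq , nonCrossing , shares₁₂ , shares₃₄ =
  S , H , wseq , nonCrossing , (i₁≢i₂ , shares₁₂) , (i₃≢i₄ , shares₃₄)
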